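{- Let $\lambda$ be a partition, $R=\mathbb{Z}[x_{ij}\colon(i,j)\in\lambda]$, and let $F=\{(i,j)\colon 1\le i\le d,\ 1\le j\le e\}$ be a $d\times e$ rectangle contained in $\lambda^*$ whose corner square $(d,e)$ lies in $\lambda^*\setminus\lambda$; assume $d\le e$. Let $W_F=(P_{ij})_{(i,j)\in F}$ be the $d\times e$ matrix over $R$. Then there are an upper unitriangular matrix $P\in\mathrm{SL}(d,R)$ and a lower unitriangular matrix $Q\in\mathrm{SL}(e,R)$ such that $$P\cdot W_F\cdot Q=(\mathbf{0},\ \mathrm{diag}(A_{1,1+e-d},A_{2,2+e-d},\dots,A_{d,e})),$$ where $\mathbf{0}$ is the $d\times(e-d)$ zero matrix. In particular, if $\lambda$ has rank $\rho$ and $F$ is the $(\rho+1)\times(\rho+1)$ square, this gives $P\,W_F\,Q=\mathrm{diag}(A_{11},\dots,A_{\rho+1,\rho+1})$.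
   Context: A partition $\lambda=(\lambda_1\ge\dots\ge\lambda_\ell>0)$ is identified with its Young diagram $\{(r,s)\colon 1\le r\le\ell,\ 1\le s\le\lambda_r\}$; its rank $\rho$ is the largest $k$ with $\lambda_k\ge k$. The extended partition $\lambda^*$ is the diagram of the partition with parts $\lambda^*_1=\lambda_1+1$ and $\lambda^*_r=\lambda_{r-1}+1$ for $2\le r\le\ell+1$ (i.e. $\lambda$ together with the border strip from the end of its first row to the end of its first column). To each square $(i,j)\in\lambda$ associate an indeterminate $x_{ij}$. For $(r,s)\in\lambda^*$ let $\lambda(r,s)$ be the partition consisting of squares $(u,v)\in\lambda$ with $u\ge r$, $v\ge s$; define $P_{rs}=\sum_{\mu\subseteq\lambda(r,s)}\prod_{(i,j)\in\lambda(r,s)\setminus\mu}x_{ij}$ (sum over partitions $\mu$ contained in $\lambda(r,s)$) and $A_{rs}=\prod_{(i,j)\in\lambda(r,s)}x_{ij}$; empty products are $1$, so $P_{rs}=A_{rs}=1$ for $(r,s)\in\lambda^*\setminus\lambda$. -}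

module Defs where

open import Level using (Level)
open import Data.Nat using (ℕ; zero; suc; _∸_; _≤_; _<_; _⊓_)
open import Data.Nat.Properties using (_≟_)
open import Data.Fin using (Fin; toℕ)
open import Data.List using (List; []; _∷_; [_]; map; concatMap; upTo; drop; length)
open import Data.List.Relation.Unary.All using (All)
open import Data.List.Relation.Unary.Linked using (Linked)
open import Data.Product using (_×_)
open import Data.Sum using (_⊎_)
open import Relation.Binary.PropositionalEquality using (_≡_)
open import Relation.Nullary using (yes; no)
open import Algebra.Bundles using (CommutativeRing)
import Data.Nat as N

-- Partitions as lists of parts (λ₁ ≥ λ₂ ≥ … ≥ λ_ℓ > 0).
-- Squares (r , s) use 1-based coordinates as in the paper.

IsPartition : List ℕ → Set
IsPartition l = All (λ a → 1 ≤ a) l × Linked (λ a b → b ≤ a) l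

-- row l r = λ_r (1-based); 0 if r = 0 or r > ℓ.
row : List ℕ → ℕ → ℕ
row []       _             = 0
row (a ∷ as) zero          = 0
row (a ∷ as) (suc zero)    = a
row (a ∷ as) (suc (suc r)) = row as (suc r)

-- Row lengths of the extended partition λ*:
-- λ*_1 = λ_1 + 1,  λ*_r = λ_{r-1} + 1 for 2 ≤ r ≤ ℓ+1, and 0 otherwise.
rowStar : List ℕ → ℕ → ℕ
rowStar l zero          = 0
rowStar l (suc zero)    = suc (row l 1)
rowStar l (suc (suc r)) with Data.Nat._≤?_ (suc r) (length l)
... | yes _ = suc (row l (suc r))
... | no  _ = 0

InDiagram : List ℕ → ℕ → ℕ → Set
InDiagram l r s = 1 ≤ r × 1 ≤ s × s ≤ row l r

InStar : List ℕ → ℕ → ℕ → Set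
InStar l r s = 1 ≤ r × 1 ≤ s × s ≤ rowStar l r

-- ρ is the rank of λ: the largest k with λ_k ≥ k (ρ = 0 if there is none).
IsRank : List ℕ → ℕ → Set
IsRank l ρ = ((ρ ≡ 0) ⊎ (ρ ≤ row l ρ)) × (∀ k → 1 ≤ k → k ≤ row l k → k ≤ ρ)

-- [a , b] as a list of naturals (empty if b < a).
range : ℕ → ℕ → List ℕ
range a b = map (a N.+_) (upTo (suc b ∸ a))

subsCap : ℕ → List ℕ → List (List ℕ)
subsCap c []       = [ [] ]
subsCap c (b ∷ bs) = concatMap (λ m → map (m ∷_) (subsCap m bs)) (upTo (suc (c ⊓ b)))

subs : List ℕ → List (List ℕ)
subs []       = [ [] ]
subs (b ∷ bs) = subsCap b (b ∷ bs)

-- Row lengths of λ(r,s) = {(u,v) ∈ λ : u ≥ r, v ≥ s}, for rows u = r, …, ℓ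
-- (row u of λ(r,s) has λ_u ∸ (s-1) squares, namely columns s … λ_u).
shiftedRows : List ℕ → ℕ → ℕ → List ℕ
shiftedRows l r s = map (λ a → a ∸ (s ∸ 1)) (drop (r ∸ 1) l)

-- Ring-valued notions, for an arbitrary commutative ring R and an
-- arbitrary assignment x : ℕ → ℕ → R of the indeterminates x_ij.

module WithRing {c ℓ : Level} (R : CommutativeRing c ℓ) where
  open CommutativeRing R 
  open import Data.Fin as F using ()

  sumL : List Carrier → Carrier
  sumL []       = 0#
  sumL (a ∷ as) = a + sumL as

  prodL : List Carrier → Carrier
  prodL []       = 1#
  prodL (a ∷ as) = a * prodL as

  sumFin : ∀ {n} → (Fin n → Carrier) → Carrier
  sumFin {zero}  f = 0#
  sumFin {suc n} f = f F.zero + sumFin (λ i → f (F.suc i))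

  Matrix : ℕ → ℕ → Set c
  Matrix m n = Fin m → Fin n → Carrier

  _⊗_ : ∀ {m n p} → Matrix m n → Matrix n p → Matrix m p
  (M ⊗ N) i k = sumFin (λ j → M i j * N j k)

  _≈M_ : ∀ {m n} → Matrix m n → Matrix m n → Set ℓ
  M ≈M N = ∀ i j → M i j ≈ N i j

  UpperUnitri : ∀ {n} → Matrix n n → Set ℓ
  UpperUnitri M = (∀ i → M i i ≈ 1#) × (∀ i j → toℕ j < toℕ i → M i j ≈ 0#)

  LowerUnitri : ∀ {n} → Matrix n n → Set ℓ
  LowerUnitri M = (∀ i → M i i ≈ 1#) × (∀ i j → toℕ i < toℕ j → M i j ≈ 0#)

  module WithVars (x : ℕ → ℕ → Carrier) (l : List ℕ) where

    -- ∏_{(i,j) ∈ λ(r,s) ∖ μ} x_ij, where μ ⊆ λ(r,s) is given by its row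
    -- lengths ms (aligned with rows r, r+1, …); row u contributes
    -- columns s + m_u, …, λ_u.
    complProd : ℕ → ℕ → List ℕ → List ℕ → Carrier
    complProd u s []       _        = 1#
    complProd u s (a ∷ as) []       =
      prodL (map (x u) (range s a)) * complProd (suc u) s as []
    complProd u s (a ∷ as) (m ∷ ms) =
      prodL (map (x u) (range (s N.+ m) a)) * complProd (suc u) s as ms

    -- P_rs = Σ_{μ ⊆ λ(r,s)} ∏_{(i,j) ∈ λ(r,s) ∖ μ} x_ij
    Pent : ℕ → ℕ → Carrier
    Pent r s = sumL (map (complProd r s (drop (r ∸ 1) l)) (subs (shiftedRows l r s)))

    -- A_rs = ∏_{(i,j) ∈ λ(r,s)} x_ij
    Aent : ℕ → ℕ → Carrier
    Aent r s = complProd r s (drop (r ∸ 1) l) []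

    W : (d e : ℕ) → Matrix d e
    W d e i j = Pent (suc (toℕ i)) (suc (toℕ j))

    Target : (d e : ℕ) → Matrix d e
    Target d e i j with toℕ j ≟ toℕ i N.+ (e ∸ d)
    ... | yes _ = Aent (suc (toℕ i)) (suc (toℕ j))
    ... | no  _ = 0#

    DiagA : (n : ℕ) → Matrix n n
    DiagA n i j with toℕ i ≟ toℕ j
    ... | yes _ = Aent (suc (toℕ i)) (suc (toℕ i))
    ... | no  _ = 0#

module Submission where

-- We factor W_F = U · T · L explicitly, where T is the target
-- matrix (0, diag(A_{1,1+e-d}, …, A_{d,e})), U is upper and L lower unitriangular;
-- then P = U⁻¹ and Q = L⁻¹ are unitriangular and P · W_F · Q = T.
--
-- All entries involved are generating functions of subdiagrams: Gen u lo hi rows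
-- sums, over the subdiagrams μ of the given rows restricted to the columns ≥ lo
-- whose first row stops before column hi, the product of x over the complement.
-- P_{rs} is such a sum (Pent-Gen), and three identities about Gen drive the proof:
--   * factoring (Gen-factor): squares beyond every possible cut contribute their
--     full product A, so a Gen is A times a Gen of rows capped at that column;
--   * triviality (Gen-trivial): with equal bounds only μ = ∅ remains, so L has 1's
--     on its diagonal;
--   * the staircase decomposition (Gen-staircase): when the rows form the staircase
--     forced by the shape of F, Gen splits according to the row where the cuts
--     cross the diagonal.
-- Together they give P_{i+1,j+1} = Σ_k U_{ik} A_{k+1,k+1+e-d} L_{k+e-d,j}, i.e.
-- W_F = U · T · L (W-factorization).

open import Defs
open import Level using (Level)
open import Data.Nat using (ℕ; suc; _≤_)
open import Data.List using (List)
open import Data.Product using (Σ; _×_)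
open import Relation.Nullary using (¬_)
open import Algebra.Bundles using (CommutativeRing)

import Data.Nat as N
open N using (zero; z≤n; s≤s; _<_; _⊓_; _⊔_; _∸_)
import Data.Nat.Properties as NP
open import Data.Nat.Tactic.RingSolver using (solve-∀)
open import Data.Fin using (Fin; toℕ) renaming (zero to fzero; suc to fsuc)
import Data.Fin.Properties as FP
open import Data.List using ([]; _∷_; map; concatMap; upTo; applyUpTo; drop; take; _++_; length)
import Data.List.Properties as LP
open import Data.Product using (_,_; proj₁; proj₂)
open import Data.Sum using (_⊎_; inj₁; inj₂)
open import Data.List.Relation.Unary.Linked using (Linked; _∷_)
open import Data.Empty using (⊥-elim)
open import Relation.Nullary using (Dec; yes; no)
import Relation.Binary.PropositionalEquality as P
open P using (_≡_; _≢_)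
open import Relation.Binary.Bundles using (Setoid)
import Relation.Binary.Reasoning.Setoid as SetoidReasoning
import Algebra.Properties.Ring as RingProperties
import Algebra.Properties.CommutativeSemigroup as CSProperties

+-<-∸ : ∀ m n o → m < n ∸ o → o N.+ m < n
+-<-∸ m n       zero    m<n = m<n
+-<-∸ m (suc n) (suc o) m<n = s≤s (+-<-∸ m n o m<n)

∸-split : ∀ {l m n} → l ≤ m → m ≤ n → n ∸ l ≡ (m ∸ l) N.+ (n ∸ m)
∸-split {l} {m} {n} l≤m m≤n = NP.+-cancelˡ-≡ l _ _ (begin
  l N.+ (n ∸ l)                  ≡⟨ NP.m+[n∸m]≡n (NP.≤-trans l≤m m≤n) ⟩
  n                              ≡⟨ NP.m+[n∸m]≡n m≤n ⟨
  m N.+ (n ∸ m)                  ≡⟨ P.cong (N._+ (n ∸ m)) (NP.m+[n∸m]≡n l≤m) ⟨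
  (l N.+ (m ∸ l)) N.+ (n ∸ m)    ≡⟨ NP.+-assoc l (m ∸ l) (n ∸ m) ⟩
  l N.+ ((m ∸ l) N.+ (n ∸ m))    ∎)
  where open P.≡-Reasoning

+-∸-reindex : ∀ {l m} k → l ≤ m → l N.+ ((m ∸ l) N.+ k) ≡ m N.+ k
+-∸-reindex {l} {m} k l≤m = P.trans (P.sym (NP.+-assoc l (m ∸ l) k)) (P.cong (N._+ k) (NP.m+[n∸m]≡n l≤m))

-- The first-row bound max(a+1, s+1) of Gen, in the form s + 1 + (a ∸ s) used by P_{rs}.
suc⊔suc : ∀ a s → suc a ⊔ suc s ≡ suc s N.+ (a ∸ s)
suc⊔suc a s with NP.≤-total a s
... | inj₁ a≤s = P.trans (NP.m≤n⇒m⊔n≡n (s≤s a≤s))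
                         (P.cong suc (P.trans (P.sym (NP.+-identityʳ s)) (P.cong (s N.+_) (P.sym (NP.m≤n⇒m∸n≡0 a≤s)))))
... | inj₂ s≤a = P.trans (NP.m≥n⇒m⊔n≡m (s≤s s≤a)) (P.cong suc (P.sym (NP.m+[n∸m]≡n s≤a)))

-- The number of admissible cuts of a row of length a in columns ≥ s+1 with cap s+1+cap.
cut-count : ∀ s cap a → suc ((suc s N.+ cap) ⊓ (suc a ⊔ suc s)) ∸ suc s ≡ suc (cap ⊓ (a ∸ s))
cut-count s cap a = begin
  suc ((suc s N.+ cap) ⊓ (suc a ⊔ suc s)) ∸ suc s          ≡⟨ P.cong (λ t → suc ((suc s N.+ cap) ⊓ t) ∸ suc s) (suc⊔suc a s) ⟩
  suc ((suc s N.+ cap) ⊓ (suc s N.+ (a ∸ s))) ∸ suc s      ≡⟨ P.cong (λ t → suc t ∸ suc s) (NP.+-distribˡ-⊓ (suc s) cap (a ∸ s)) ⟨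
  suc (suc s N.+ (cap ⊓ (a ∸ s))) ∸ suc s                  ≡⟨ P.cong (_∸ suc s) (NP.+-suc (suc s) (cap ⊓ (a ∸ s))) ⟨
  (suc s N.+ suc (cap ⊓ (a ∸ s))) ∸ suc s                  ≡⟨ NP.m+n∸m≡n (suc s) _ ⟩
  suc (cap ⊓ (a ∸ s))                                      ∎
  where open P.≡-Reasoning

-- Index bookkeeping for the crossing at row K of the staircase starting at row i.
column-shift : ∀ K i off → K N.+ suc (i N.+ off) ≡ suc ((i N.+ K) N.+ off)
column-shift = solve-∀

row-shift : ∀ K i → K N.+ suc i ≡ suc (i N.+ K)
row-shift = solve-∀

-- Capping a row at c does not change the admissible cuts when the cap hi ≤ c+1.
capped-top : ∀ lo hi a c → hi ≤ suc c → hi ⊓ (suc (a ⊓ c) ⊔ lo) ≡ hi ⊓ (suc a ⊔ lo)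
capped-top lo hi a c hi≤c+1 with NP.≤-total a c
... | inj₁ a≤c = P.cong (λ t → hi ⊓ (suc t ⊔ lo)) (NP.m≤n⇒m⊓n≡m a≤c)
... | inj₂ c≤a rewrite NP.m≥n⇒m⊓n≡n c≤a =
  P.trans (NP.m≤n⇒m⊓n≡m (NP.≤-trans hi≤c+1 (NP.m≤m⊔n (suc c) lo)))
          (P.sym (NP.m≤n⇒m⊓n≡m (NP.≤-trans hi≤c+1 (NP.≤-trans (s≤s c≤a) (NP.m≤m⊔n (suc a) lo)))))

-- The staircase from row i+1 with diagonal column i + off + 1 reaches row d = i+1+N
-- at column d + off.
corner-shift : ∀ i N off → suc (i N.+ off) N.+ N ≡ (suc i N.+ N) N.+ off
corner-shift = solve-∀

-- Staircase lo c rows N: row t of `rows` (counted from 0) meets the diagonal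
-- column c + t; the first N rows reach beyond the diagonal (length ≥ c + N - 1),
-- row N is shorter than c + N or absent, and the lower bound lo is ≤ c + N.
data Staircase (lo : ℕ) : ℕ → List ℕ → ℕ → Set where
  end   : ∀ {c} → lo ≤ c → Staircase lo c [] 0
  short : ∀ {c a as} → a < c → lo ≤ c → Staircase lo c (a ∷ as) 0
  long  : ∀ {c a as N} → c N.+ N ≤ a → Staircase lo (suc c) as N → Staircase lo c (a ∷ as) (suc N)

module Shapes where
  drop-[] : ∀ i → drop {A = ℕ} i [] ≡ []
  drop-[] zero    = P.refl
  drop-[] (suc i) = P.refl

  drop-row : ∀ (l : List ℕ) i → (drop i l ≡ [] × row l (suc i) ≡ 0) ⊎ (drop i l ≡ row l (suc i) ∷ drop (suc i) l)
  drop-row []       i       = inj₁ (drop-[] i , P.refl)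
  drop-row (a ∷ as) zero    = inj₂ P.refl
  drop-row (a ∷ as) (suc i) = drop-row as i

  rowStar-bound : ∀ l r {e} → 1 ≤ e → e ≤ rowStar l (suc (suc r)) → e ≤ suc (row l (suc r))
  rowStar-bound l r 1≤e e≤ with suc r N.≤? length l
  ... | yes _ = e≤
  ... | no  _ = ⊥-elim (NP.<-irrefl P.refl (NP.≤-trans 1≤e e≤))

  rowStar-from-row : ∀ l r {e} → suc r ≤ length l → e ≤ suc (row l (suc r)) → e ≤ rowStar l (suc (suc r))
  rowStar-from-row l r r+1≤ℓ e≤ with suc r N.≤? length l
  ... | yes _    = e≤
  ... | no  r+1≰ℓ = ⊥-elim (r+1≰ℓ r+1≤ℓ)

  row-length : ∀ l r → 1 ≤ row l r → r ≤ length l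
  row-length (a ∷ as) zero          _  = z≤n
  row-length (a ∷ as) (suc zero)    _  = s≤s z≤n
  row-length (a ∷ as) (suc (suc r)) 1≤ = s≤s (row-length as (suc r) 1≤)

  row-step : ∀ l → Linked (λ a b → b ≤ a) l → ∀ r → row l (suc (suc r)) ≤ row l (suc r)
  row-step []           _            r       = z≤n
  row-step (a ∷ [])     _            r       = z≤n
  row-step (a ∷ b ∷ as) (b≤a ∷ _)    zero    = b≤a
  row-step (a ∷ b ∷ as) (_   ∷ desc) (suc r) = row-step (b ∷ as) desc r

  row-mono : ∀ l → Linked (λ a b → b ≤ a) l → ∀ r k → row l (suc r N.+ k) ≤ row l (suc r)
  row-mono l desc r zero    = NP.≤-reflexive (P.cong (row l) (NP.+-identityʳ (suc r)))
  row-mono l desc r (suc k) = NP.≤-trans (NP.≤-reflexive (P.cong (row l) (NP.+-suc (suc r) k)))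
                                         (NP.≤-trans (row-step l desc (r N.+ k)) (row-mono l desc r k))

  -- The shape hypotheses on the rectangle F = [1,d] × [1,e] ⊆ λ* with (d,e) ∉ λ:
  -- rows 1 … d-1 of λ have length ≥ e - 1 and row d has length < e.
  module Rectangle (l : List ℕ) (d e : ℕ) (1≤d : 1 ≤ d) (d≤e : d ≤ e)
                   (F⊆λ* : ∀ i j → 1 ≤ i → i ≤ d → 1 ≤ j → j ≤ e → InStar l i j)
                   (corner∉λ : ¬ InDiagram l d e) where
    off : ℕ
    off = e ∸ d

    1≤e : 1 ≤ e
    1≤e = NP.≤-trans 1≤d d≤e

    long-rows : ∀ r → suc r < d → e ≤ suc (row l (suc r))
    long-rows r r+1<d = rowStar-bound l r 1≤e (proj₂ (proj₂ (F⊆λ* (suc (suc r)) e (s≤s z≤n) r+1<d 1≤e NP.≤-refl)))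

    short-row : row l d < e
    short-row = NP.≰⇒> (λ e≤λd → corner∉λ (1≤d , 1≤e , e≤λd))

    -- Row i+1+N = d is the short row: the diagonal column there is e.
    corner : ∀ i N → suc i N.+ N ≡ d → suc (i N.+ off) N.+ N ≡ e
    corner i N i+N+1≡d = P.trans (corner-shift i N off) (P.trans (P.cong (N._+ off) i+N+1≡d) (NP.m+[n∸m]≡n d≤e))

    corner-col : ∀ i → suc i N.+ 0 ≡ d → e ≡ suc (i N.+ off)
    corner-col i i+1≡d = P.trans (P.sym (corner i 0 i+1≡d)) (NP.+-identityʳ _)

    i+1<d : ∀ i N → suc i N.+ suc N ≡ d → suc i < d
    i+1<d i N i+N+2≡d = P.subst (suc (suc i) ≤_) (P.trans (P.sym (NP.+-suc (suc i) N)) i+N+2≡d) (NP.m≤m+n (suc (suc i)) N)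

    staircase : ∀ j → j < e → ∀ N i → suc i N.+ N ≡ d → Staircase (suc j) (suc (i N.+ off)) (drop i l) N
    staircase j j<e N i i+N+1≡d with drop-row l i
    staircase j j<e zero i i+1≡d | inj₁ (rows≡[] , _) rewrite rows≡[] =
      end (P.subst (suc j ≤_) (corner-col i i+1≡d) j<e)
    staircase j j<e zero i i+1≡d | inj₂ rows≡ rewrite rows≡ =
      short (P.subst₂ (λ r c → row l r < c) (P.trans (P.sym i+1≡d) (NP.+-identityʳ (suc i))) (corner-col i i+1≡d) short-row)
            (P.subst (suc j ≤_) (corner-col i i+1≡d) j<e)
    staircase j j<e (suc N) i i+N+2≡d | inj₁ (_ , λ≡0) =
      ⊥-elim (NP.<-irrefl P.refl (NP.≤-trans 2≤e (P.subst (λ a → e ≤ suc a) λ≡0 (long-rows i (i+1<d i N i+N+2≡d)))))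
      where
        2≤e : 2 ≤ e
        2≤e = NP.≤-trans (P.subst (2 ≤_) i+N+2≡d (s≤s (P.subst (1 ≤_) (P.sym (NP.+-suc i N)) (s≤s z≤n)))) d≤e
    staircase j j<e (suc N) i i+N+2≡d | inj₂ rows≡ rewrite rows≡ =
      long (NP.≤-pred (P.subst (_≤ suc (row l (suc i))) e≡ (long-rows i (i+1<d i N i+N+2≡d))))
           (staircase j j<e N (suc i) (P.trans (P.sym (NP.+-suc (suc i) N)) i+N+2≡d))
      where
        e≡ : e ≡ suc (suc (i N.+ off) N.+ N)
        e≡ = P.trans (P.sym (corner i (suc N) i+N+2≡d)) (NP.+-suc (suc (i N.+ off)) N)

  module Square (l : List ℕ) (desc : Linked (λ a b → b ≤ a) l) (ρ : ℕ) (rank : IsRank l ρ) where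
    long-rows : ∀ r → r < ρ → ρ ≤ row l (suc r)
    long-rows r r<ρ with proj₁ rank
    ... | inj₁ ρ≡0   = ⊥-elim (NP.n≮0 (P.subst (r <_) ρ≡0 r<ρ))
    ... | inj₂ ρ≤λρ = NP.≤-trans ρ≤λρ
      (P.subst (λ k → row l k ≤ row l (suc r)) (NP.m+[n∸m]≡n r<ρ) (row-mono l desc r (ρ ∸ suc r)))

    first-row : ρ ≤ row l 1
    first-row with 1 N.≤? ρ
    ... | yes 1≤ρ = long-rows 0 1≤ρ
    ... | no  1≰ρ = NP.≤-trans (NP.≤-pred (NP.≰⇒> 1≰ρ)) z≤n

    square⊆λ* : ∀ i j → 1 ≤ i → i ≤ suc ρ → 1 ≤ j → j ≤ suc ρ → InStar l i j
    square⊆λ* (suc zero)    j 1≤i _             1≤j j≤ρ+1 = 1≤i , 1≤j , NP.≤-trans j≤ρ+1 (s≤s first-row)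
    square⊆λ* (suc (suc i)) j 1≤i (s≤s i+1≤ρ) 1≤j j≤ρ+1 =
      1≤i , 1≤j , rowStar-from-row l i (row-length l (suc i) (NP.≤-trans (s≤s z≤n) (NP.≤-trans i+1≤ρ ρ≤λ)))
                                       (NP.≤-trans j≤ρ+1 (s≤s ρ≤λ))
      where
        ρ≤λ : ρ ≤ row l (suc i)
        ρ≤λ = long-rows i i+1≤ρ

    corner∉λ : ¬ InDiagram l (suc ρ) (suc ρ)
    corner∉λ (_ , _ , ρ+1≤λ) = NP.<-irrefl P.refl (proj₂ rank (suc ρ) (s≤s z≤n) ρ+1≤λ)

module FiniteSums {c ℓ : Level} (R : CommutativeRing c ℓ) where
  open CommutativeRing R
  open WithRing R
  open SetoidReasoning setoid
  open CSProperties +-commutativeSemigroup using () renaming (interchange to +-interchange)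

  sumN : ℕ → (ℕ → Carrier) → Carrier
  sumN zero    f = 0#
  sumN (suc n) f = f 0 + sumN n (λ k → f (suc k))

  sumN-cong : ∀ n {f g : ℕ → Carrier} → (∀ k → k < n → f k ≈ g k) → sumN n f ≈ sumN n g
  sumN-cong zero    f≈g = refl
  sumN-cong (suc n) f≈g = +-cong (f≈g 0 (s≤s z≤n)) (sumN-cong n (λ k k<n → f≈g (suc k) (s≤s k<n)))

  sumN-vanish : ∀ n {f : ℕ → Carrier} → (∀ k → k < n → f k ≈ 0#) → sumN n f ≈ 0#
  sumN-vanish zero    f≈0 = refl
  sumN-vanish (suc n) f≈0 =
    trans (+-cong (f≈0 0 (s≤s z≤n)) (sumN-vanish n (λ k k<n → f≈0 (suc k) (s≤s k<n)))) (+-identityˡ 0#)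

  sumN-+ : ∀ n (f g : ℕ → Carrier) → sumN n (λ k → f k + g k) ≈ sumN n f + sumN n g
  sumN-+ zero    f g = sym (+-identityˡ 0#)
  sumN-+ (suc n) f g = trans (+-congˡ (sumN-+ n _ _)) (+-interchange _ _ _ _)

  sumN-*ˡ : ∀ n a (f : ℕ → Carrier) → a * sumN n f ≈ sumN n (λ k → a * f k)
  sumN-*ˡ zero    a f = zeroʳ a
  sumN-*ˡ (suc n) a f = trans (distribˡ a _ _) (+-congˡ (sumN-*ˡ n a _))

  sumN-*ʳ : ∀ n a (f : ℕ → Carrier) → sumN n f * a ≈ sumN n (λ k → f k * a)
  sumN-*ʳ zero    a f = zeroˡ a
  sumN-*ʳ (suc n) a f = trans (distribʳ a _ _) (+-congˡ (sumN-*ʳ n a _))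

  sumN-swap : ∀ m n (f : ℕ → ℕ → Carrier) →
    sumN m (λ i → sumN n (f i)) ≈ sumN n (λ j → sumN m (λ i → f i j))
  sumN-swap zero    n f = sym (sumN-vanish n (λ _ _ → refl))
  sumN-swap (suc m) n f = begin
    sumN n (f 0) + sumN m (λ i → sumN n (f (suc i)))
      ≈⟨ +-congˡ (sumN-swap m n (λ i → f (suc i))) ⟩
    sumN n (f 0) + sumN n (λ j → sumN m (λ i → f (suc i) j))
      ≈⟨ sumN-+ n _ _ ⟨
    sumN n (λ j → f 0 j + sumN m (λ i → f (suc i) j)) ∎

  sumN-split : ∀ p q (f : ℕ → Carrier) → sumN (p N.+ q) f ≈ sumN p f + sumN q (λ k → f (p N.+ k))
  sumN-split zero    q f = sym (+-identityˡ _)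
  sumN-split (suc p) q f = trans (+-congˡ (sumN-split p q (λ k → f (suc k)))) (sym (+-assoc _ _ _))

  sumN-single : ∀ n t (h : ℕ → Carrier) → t < n → (∀ m → m ≢ t → h m ≈ 0#) → sumN n h ≈ h t
  sumN-single (suc n) zero    h _         h≈0 =
    trans (+-congˡ (sumN-vanish n (λ m _ → h≈0 (suc m) (λ ())))) (+-identityʳ _)
  sumN-single (suc n) (suc t) h (s≤s t<n) h≈0 =
    trans (+-cong (h≈0 0 (λ ())) (sumN-single n t (λ m → h (suc m)) t<n (λ m m≢t → h≈0 (suc m) (λ { P.refl → m≢t P.refl }))))
          (+-identityˡ _)

  sumFrom : ℕ → ℕ → (ℕ → Carrier) → Carrier
  sumFrom lo hi f = sumN (hi ∸ lo) (λ m → f (lo N.+ m))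

  sumFrom-cong : ∀ lo hi {f g : ℕ → Carrier} → (∀ n → lo ≤ n → n < hi → f n ≈ g n) →
    sumFrom lo hi f ≈ sumFrom lo hi g
  sumFrom-cong lo hi f≈g = sumN-cong (hi ∸ lo) (λ m m< → f≈g (lo N.+ m) (NP.m≤m+n lo m) (+-<-∸ m hi lo m<))

  sumFrom-vanish : ∀ lo hi {f : ℕ → Carrier} → (∀ n → lo ≤ n → n < hi → f n ≈ 0#) → sumFrom lo hi f ≈ 0#
  sumFrom-vanish lo hi f≈0 = sumN-vanish (hi ∸ lo) (λ m m< → f≈0 (lo N.+ m) (NP.m≤m+n lo m) (+-<-∸ m hi lo m<))

  sumFrom-empty : ∀ lo hi (f : ℕ → Carrier) → hi ≤ lo → sumFrom lo hi f ≡ 0#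
  sumFrom-empty lo hi f hi≤lo = P.cong (λ n → sumN n (λ m → f (lo N.+ m))) (NP.m≤n⇒m∸n≡0 hi≤lo)

  sumFrom-split : ∀ {lo mid hi} (f : ℕ → Carrier) → lo ≤ mid → mid ≤ hi →
    sumFrom lo hi f ≈ sumFrom lo mid f + sumFrom mid hi f
  sumFrom-split {lo} {mid} {hi} f lo≤mid mid≤hi = begin
    sumN (hi ∸ lo) (λ m → f (lo N.+ m))
      ≡⟨ P.cong (λ n → sumN n (λ m → f (lo N.+ m))) (∸-split lo≤mid mid≤hi) ⟩
    sumN ((mid ∸ lo) N.+ (hi ∸ mid)) (λ m → f (lo N.+ m))
      ≈⟨ sumN-split (mid ∸ lo) (hi ∸ mid) _ ⟩
    sumFrom lo mid f + sumN (hi ∸ mid) (λ k → f (lo N.+ ((mid ∸ lo) N.+ k)))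
      ≈⟨ +-congˡ (sumN-cong (hi ∸ mid) (λ k _ → reflexive (P.cong f (+-∸-reindex k lo≤mid)))) ⟩
    sumFrom lo mid f + sumFrom mid hi f ∎

  sumFrom-split⊔ : ∀ lo mid hi (f : ℕ → Carrier) → mid ≤ hi →
    sumFrom lo hi f ≈ sumFrom lo mid f + sumFrom (lo ⊔ mid) hi f
  sumFrom-split⊔ lo mid hi f mid≤hi with NP.≤-total lo mid
  ... | inj₁ lo≤mid rewrite NP.m≤n⇒m⊔n≡n lo≤mid = sumFrom-split f lo≤mid mid≤hi
  ... | inj₂ mid≤lo rewrite NP.m≥n⇒m⊔n≡m mid≤lo | sumFrom-empty lo mid f mid≤lo = sym (+-identityˡ _)

  sumFrom-skip : ∀ {p q} hi (f : ℕ → Carrier) → p ≤ q → (∀ n → p ≤ n → n < q → f n ≈ 0#) →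
    sumFrom p hi f ≈ sumFrom q hi f
  sumFrom-skip {p} {q} hi f p≤q f≈0 with q N.≤? hi
  ... | yes q≤hi = begin
    sumFrom p hi f                  ≈⟨ sumFrom-split f p≤q q≤hi ⟩
    sumFrom p q f + sumFrom q hi f  ≈⟨ +-congʳ (sumFrom-vanish p q f≈0) ⟩
    0# + sumFrom q hi f             ≈⟨ +-identityˡ _ ⟩
    sumFrom q hi f                  ∎
  ... | no q≰hi = begin
    sumFrom p hi f  ≈⟨ sumFrom-vanish p hi (λ n p≤n n<hi → f≈0 n p≤n (NP.<-≤-trans n<hi hi≤q)) ⟩
    0#              ≡⟨ sumFrom-empty q hi f hi≤q ⟨
    sumFrom q hi f  ∎
    where
      hi≤q : hi ≤ q
      hi≤q = NP.<⇒≤ (NP.≰⇒> q≰hi)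

  sumFrom-single : ∀ n (f : ℕ → Carrier) → sumFrom n (suc n) f ≈ f n
  sumFrom-single n f = begin
    sumN (suc n ∸ n) (λ m → f (n N.+ m))
      ≡⟨ P.cong (λ k → sumN k (λ m → f (n N.+ m))) (P.trans (NP.+-∸-assoc 1 (NP.≤-refl {n})) (P.cong suc (NP.n∸n≡0 n))) ⟩
    f (n N.+ 0) + 0#  ≈⟨ +-identityʳ _ ⟩
    f (n N.+ 0)       ≡⟨ P.cong f (NP.+-identityʳ n) ⟩
    f n               ∎

  prodN : ℕ → (ℕ → Carrier) → Carrier
  prodN zero    f = 1#
  prodN (suc n) f = f 0 * prodN n (λ k → f (suc k))

  prodFrom : ℕ → ℕ → (ℕ → Carrier) → Carrier
  prodFrom lo hi f = prodN (hi ∸ lo) (λ m → f (lo N.+ m))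

  prodN-split : ∀ p q (f : ℕ → Carrier) → prodN (p N.+ q) f ≈ prodN p f * prodN q (λ k → f (p N.+ k))
  prodN-split zero    q f = sym (*-identityˡ _)
  prodN-split (suc p) q f = trans (*-congˡ (prodN-split p q (λ k → f (suc k)))) (sym (*-assoc _ _ _))

  prodN-cong : ∀ n {f g : ℕ → Carrier} → (∀ k → f k ≡ g k) → prodN n f ≈ prodN n g
  prodN-cong zero    f≡g = refl
  prodN-cong (suc n) f≡g = *-cong (reflexive (f≡g 0)) (prodN-cong n (λ k → f≡g (suc k)))

  prodFrom-split : ∀ {lo mid hi} (f : ℕ → Carrier) → lo ≤ mid → mid ≤ hi →
    prodFrom lo hi f ≈ prodFrom lo mid f * prodFrom mid hi f
  prodFrom-split {lo} {mid} {hi} f lo≤mid mid≤hi = begin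
    prodN (hi ∸ lo) (λ m → f (lo N.+ m))
      ≡⟨ P.cong (λ n → prodN n (λ m → f (lo N.+ m))) (∸-split lo≤mid mid≤hi) ⟩
    prodN ((mid ∸ lo) N.+ (hi ∸ mid)) (λ m → f (lo N.+ m))
      ≈⟨ prodN-split (mid ∸ lo) (hi ∸ mid) _ ⟩
    prodFrom lo mid f * prodN (hi ∸ mid) (λ k → f (lo N.+ ((mid ∸ lo) N.+ k)))
      ≈⟨ *-congˡ (prodN-cong (hi ∸ mid) (λ k → P.cong f (+-∸-reindex k lo≤mid))) ⟩
    prodFrom lo mid f * prodFrom mid hi f ∎

  prodFrom-empty : ∀ lo hi (f : ℕ → Carrier) → hi ≤ lo → prodFrom lo hi f ≡ 1#
  prodFrom-empty lo hi f hi≤lo = P.cong (λ n → prodN n (λ m → f (lo N.+ m))) (NP.m≤n⇒m∸n≡0 hi≤lo)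

  sumL-applyUpTo : ∀ (f : ℕ → Carrier) (h : ℕ → ℕ) k → sumL (map f (applyUpTo h k)) ≈ sumN k (λ m → f (h m))
  sumL-applyUpTo f h zero    = refl
  sumL-applyUpTo f h (suc k) = +-congˡ (sumL-applyUpTo f (λ m → h (suc m)) k)

  prodL-applyUpTo : ∀ (f : ℕ → Carrier) (h : ℕ → ℕ) k → prodL (map f (applyUpTo h k)) ≈ prodN k (λ m → f (h m))
  prodL-applyUpTo f h zero    = refl
  prodL-applyUpTo f h (suc k) = *-congˡ (prodL-applyUpTo f (λ m → h (suc m)) k)

  prodL-range : ∀ (f : ℕ → Carrier) s a → prodL (map f (range s a)) ≈ prodFrom s (suc a) f
  prodL-range f s a = trans
    (reflexive (P.cong (λ z → prodL (map f z)) (LP.map-applyUpTo (λ z → z) (s N.+_) (suc a ∸ s))))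
    (prodL-applyUpTo f (s N.+_) (suc a ∸ s))

  sumL-++ : ∀ xs ys → sumL (xs ++ ys) ≈ sumL xs + sumL ys
  sumL-++ []       ys = sym (+-identityˡ _)
  sumL-++ (z ∷ xs) ys = trans (+-congˡ (sumL-++ xs ys)) (sym (+-assoc _ _ _))

  sumL-map-cong : ∀ {A : Set} {f g : A → Carrier} (xs : List A) → (∀ y → f y ≈ g y) →
    sumL (map f xs) ≈ sumL (map g xs)
  sumL-map-cong []       f≈g = refl
  sumL-map-cong (y ∷ xs) f≈g = +-cong (f≈g y) (sumL-map-cong xs f≈g)

  sumL-concatMap : ∀ {A B : Set} (f : B → Carrier) (g : A → List B) (xs : List A) →
    sumL (map f (concatMap g xs)) ≈ sumL (map (λ y → sumL (map f (g y))) xs)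
  sumL-concatMap f g []       = refl
  sumL-concatMap f g (y ∷ xs) = begin
    sumL (map f (g y ++ concatMap g xs))              ≡⟨ P.cong sumL (LP.map-++ f (g y) (concatMap g xs)) ⟩
    sumL (map f (g y) ++ map f (concatMap g xs))      ≈⟨ sumL-++ (map f (g y)) _ ⟩
    sumL (map f (g y)) + sumL (map f (concatMap g xs)) ≈⟨ +-congˡ (sumL-concatMap f g xs) ⟩
    sumL (map f (g y)) + sumL (map (λ y → sumL (map f (g y))) xs) ∎

  sumL-*ˡ : ∀ {A : Set} a (g : A → Carrier) (xs : List A) → sumL (map (λ z → a * g z) xs) ≈ a * sumL (map g xs)
  sumL-*ˡ a g []       = sym (zeroʳ a)
  sumL-*ˡ a g (y ∷ xs) = trans (+-congˡ (sumL-*ˡ a g xs)) (sym (distribˡ a _ _))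

module Matrices {c ℓ : Level} (R : CommutativeRing c ℓ) where
  open CommutativeRing R
  open WithRing R
  open FiniteSums R
  open SetoidReasoning setoid
  open CSProperties +-commutativeSemigroup using () renaming (interchange to +-interchange)
  open RingProperties ring using (-‿distribˡ-*; -0#≈0#; -‿+-comm)

  sumFin-cong : ∀ n {f g : Fin n → Carrier} → (∀ k → f k ≈ g k) → sumFin f ≈ sumFin g
  sumFin-cong zero    f≈g = refl
  sumFin-cong (suc n) f≈g = +-cong (f≈g fzero) (sumFin-cong n (λ k → f≈g (fsuc k)))

  sumFin-vanish : ∀ n {f : Fin n → Carrier} → (∀ k → f k ≈ 0#) → sumFin f ≈ 0#
  sumFin-vanish zero    f≈0 = refl
  sumFin-vanish (suc n) f≈0 = trans (+-cong (f≈0 fzero) (sumFin-vanish n (λ k → f≈0 (fsuc k)))) (+-identityˡ 0#)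

  sumFin-+ : ∀ n (f g : Fin n → Carrier) → sumFin (λ k → f k + g k) ≈ sumFin f + sumFin g
  sumFin-+ zero    f g = sym (+-identityˡ 0#)
  sumFin-+ (suc n) f g = trans (+-congˡ (sumFin-+ n _ _)) (+-interchange _ _ _ _)

  sumFin-*ˡ : ∀ n a (f : Fin n → Carrier) → a * sumFin f ≈ sumFin (λ k → a * f k)
  sumFin-*ˡ zero    a f = zeroʳ a
  sumFin-*ˡ (suc n) a f = trans (distribˡ a _ _) (+-congˡ (sumFin-*ˡ n a _))

  sumFin-*ʳ : ∀ n a (f : Fin n → Carrier) → sumFin f * a ≈ sumFin (λ k → f k * a)
  sumFin-*ʳ zero    a f = zeroˡ a
  sumFin-*ʳ (suc n) a f = trans (distribʳ a _ _) (+-congˡ (sumFin-*ʳ n a _))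

  sumFin-neg : ∀ n (f : Fin n → Carrier) → sumFin (λ k → - f k) ≈ - sumFin f
  sumFin-neg zero    f = sym -0#≈0#
  sumFin-neg (suc n) f = trans (+-congˡ (sumFin-neg n _)) (-‿+-comm _ _)

  sumFin-swap : ∀ m n (f : Fin m → Fin n → Carrier) →
    sumFin (λ i → sumFin (f i)) ≈ sumFin (λ j → sumFin (λ i → f i j))
  sumFin-swap zero    n f = sym (sumFin-vanish n (λ _ → refl))
  sumFin-swap (suc m) n f = trans (+-congˡ (sumFin-swap m n (λ i → f (fsuc i)))) (sym (sumFin-+ n _ _))

  sumFin-toℕ : ∀ n (f : ℕ → Carrier) → sumFin {n} (λ i → f (toℕ i)) ≡ sumN n f
  sumFin-toℕ zero    f = P.refl
  sumFin-toℕ (suc n) f = P.cong (f 0 +_) (sumFin-toℕ n (λ k → f (suc k)))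

  Id : ∀ {n} → Matrix n n
  Id fzero    fzero    = 1#
  Id fzero    (fsuc _) = 0#
  Id (fsuc _) fzero    = 0#
  Id (fsuc i) (fsuc j) = Id i j

  Id-sym : ∀ {n} (i j : Fin n) → Id i j ≡ Id j i
  Id-sym fzero    fzero    = P.refl
  Id-sym fzero    (fsuc j) = P.refl
  Id-sym (fsuc i) fzero    = P.refl
  Id-sym (fsuc i) (fsuc j) = Id-sym i j

  transpose : ∀ {m n} → Matrix m n → Matrix n m
  transpose A i j = A j i

  ≈M-refl : ∀ {m n} {A : Matrix m n} → A ≈M A
  ≈M-refl i j = refl

  ≈M-sym : ∀ {m n} {A B : Matrix m n} → A ≈M B → B ≈M A
  ≈M-sym A≈B i j = sym (A≈B i j)

  ≈M-setoid : ℕ → ℕ → Setoid _ _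
  ≈M-setoid m n = record
    { Carrier = Matrix m n ; _≈_ = _≈M_
    ; isEquivalence = record { refl = ≈M-refl ; sym = ≈M-sym ; trans = λ e f i j → trans (e i j) (f i j) } }

  ⊗-cong : ∀ {m n p} {A A' : Matrix m n} {B B' : Matrix n p} → A ≈M A' → B ≈M B' → (A ⊗ B) ≈M (A' ⊗ B')
  ⊗-cong {n = n} eA eB i k = sumFin-cong n (λ j → *-cong (eA i j) (eB j k))

  ⊗-assoc : ∀ {m n p q} (A : Matrix m n) (B : Matrix n p) (C : Matrix p q) → ((A ⊗ B) ⊗ C) ≈M (A ⊗ (B ⊗ C))
  ⊗-assoc {n = n} {p} A B C i l = begin
    sumFin (λ k → sumFin (λ j → A i j * B j k) * C k l)    ≈⟨ sumFin-cong p (λ k → sumFin-*ʳ n (C k l) _) ⟩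
    sumFin (λ k → sumFin (λ j → (A i j * B j k) * C k l))  ≈⟨ sumFin-swap p n _ ⟩
    sumFin (λ j → sumFin (λ k → (A i j * B j k) * C k l))  ≈⟨ sumFin-cong n (λ j → sumFin-cong p (λ k → *-assoc _ _ _)) ⟩
    sumFin (λ j → sumFin (λ k → A i j * (B j k * C k l)))  ≈⟨ sumFin-cong n (λ j → sumFin-*ˡ p (A i j) _) ⟨
    sumFin (λ j → A i j * sumFin (λ k → B j k * C k l))    ∎

  ⊗-identityˡ : ∀ {n m} (A : Matrix n m) → (Id ⊗ A) ≈M A
  ⊗-identityˡ {suc n} A fzero j = begin
    1# * A fzero j + sumFin (λ k → 0# * A (fsuc k) j) ≈⟨ +-cong (*-identityˡ _) (sumFin-vanish n (λ k → zeroˡ _)) ⟩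
    A fzero j + 0#                                     ≈⟨ +-identityʳ _ ⟩
    A fzero j                                          ∎
  ⊗-identityˡ {suc n} A (fsuc i) j = begin
    0# * A fzero j + sumFin (λ k → Id i k * A (fsuc k) j) ≈⟨ +-cong (zeroˡ _) (⊗-identityˡ (λ k → A (fsuc k)) i j) ⟩
    0# + A (fsuc i) j                                      ≈⟨ +-identityˡ _ ⟩
    A (fsuc i) j                                           ∎

  ⊗-identityʳ : ∀ {n m} (A : Matrix m n) → (A ⊗ Id) ≈M A
  ⊗-identityʳ {suc n} A i fzero = begin
    A i fzero * 1# + sumFin (λ k → A i (fsuc k) * 0#) ≈⟨ +-cong (*-identityʳ _) (sumFin-vanish n (λ k → zeroʳ _)) ⟩
    A i fzero + 0#                                     ≈⟨ +-identityʳ _ ⟩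
    A i fzero                                          ∎
  ⊗-identityʳ {suc n} A i (fsuc j) = begin
    A i fzero * 0# + sumFin (λ k → A i (fsuc k) * Id k j) ≈⟨ +-cong (zeroʳ _) (⊗-identityʳ (λ i k → A i (fsuc k)) i j) ⟩
    0# + A i (fsuc j)                                      ≈⟨ +-identityˡ _ ⟩
    A i (fsuc j)                                           ∎

  transpose-⊗ : ∀ {m n p} (A : Matrix m n) (B : Matrix n p) → transpose (A ⊗ B) ≈M (transpose B ⊗ transpose A)
  transpose-⊗ {n = n} A B i k = sumFin-cong n (λ j → *-comm _ _)

  -- Every upper unitriangular matrix U has an upper unitriangular left inverse.
  -- Block recursion: U = [[1, u], [0, U']] has inverse [[1, -u U'⁻¹], [0, U'⁻¹]].
  upper-inverse : ∀ n (U : Matrix n n) → UpperUnitri U → Σ (Matrix n n) λ V → UpperUnitri V × (V ⊗ U) ≈M Id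
  upper-inverse zero    U _ = (λ ()) , ((λ ()) , (λ ())) , (λ ())
  upper-inverse (suc n) U (U-diag , U-below) = V , (V-diag , V-below) , V⊗U≈Id
    where
      U' : Matrix n n
      U' i j = U (fsuc i) (fsuc j)
      U'-inverse : Σ (Matrix n n) λ V' → UpperUnitri V' × (V' ⊗ U') ≈M Id
      U'-inverse = upper-inverse n U' ((λ i → U-diag (fsuc i)) , (λ i j j<i → U-below (fsuc i) (fsuc j) (s≤s j<i)))
      open Σ U'-inverse renaming (proj₁ to V'; proj₂ to V'-props)
      V'-unitri : UpperUnitri V'
      V'-unitri = proj₁ V'-props
      V'⊗U'≈Id : (V' ⊗ U') ≈M Id
      V'⊗U'≈Id = proj₂ V'-props
      u : Matrix 1 n
      u _ j = U fzero (fsuc j)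
      V : Matrix (suc n) (suc n)
      V fzero    fzero    = 1#
      V fzero    (fsuc k) = - ((u ⊗ V') fzero k)
      V (fsuc i) fzero    = 0#
      V (fsuc i) (fsuc k) = V' i k
      V-diag : ∀ i → V i i ≈ 1#
      V-diag fzero    = refl
      V-diag (fsuc i) = proj₁ V'-unitri i
      V-below : ∀ i j → toℕ j < toℕ i → V i j ≈ 0#
      V-below (fsuc i) fzero    _         = refl
      V-below (fsuc i) (fsuc j) (s≤s j<i) = proj₂ V'-unitri i j j<i
      first-column-vanishes : ∀ {f : Fin n → Carrier} → sumFin (λ k → f k * U (fsuc k) fzero) ≈ 0#
      first-column-vanishes = sumFin-vanish n (λ k → trans (*-congˡ (U-below (fsuc k) fzero (s≤s z≤n))) (zeroʳ _))
      V⊗U≈Id : (V ⊗ U) ≈M Id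
      V⊗U≈Id fzero fzero = begin
        1# * U fzero fzero + sumFin (λ k → V fzero (fsuc k) * U (fsuc k) fzero)
          ≈⟨ +-cong (trans (*-identityˡ _) (U-diag fzero)) first-column-vanishes ⟩
        1# + 0# ≈⟨ +-identityʳ _ ⟩
        1#      ∎
      V⊗U≈Id fzero (fsuc j) = begin
        1# * U fzero (fsuc j) + sumFin (λ k → - ((u ⊗ V') fzero k) * U' k j)
          ≈⟨ +-cong (*-identityˡ _) (trans (sumFin-cong n (λ k → sym (-‿distribˡ-* _ _))) (sumFin-neg n _)) ⟩
        U fzero (fsuc j) + - (((u ⊗ V') ⊗ U') fzero j)
          ≈⟨ +-congˡ (-‿cong (trans (⊗-assoc u V' U' fzero j)
                               (trans (⊗-cong {A = u} (λ _ _ → refl) V'⊗U'≈Id fzero j) (⊗-identityʳ u fzero j)))) ⟩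
        U fzero (fsuc j) + - U fzero (fsuc j) ≈⟨ -‿inverseʳ _ ⟩
        0# ∎
      V⊗U≈Id (fsuc i) fzero    = trans (+-cong (zeroˡ _) first-column-vanishes) (+-identityʳ _)
      V⊗U≈Id (fsuc i) (fsuc j) = trans (+-cong (zeroˡ _) (V'⊗U'≈Id i j)) (+-identityˡ _)

  -- The lower unitriangular case, by transposition.
  lower-inverse : ∀ n (L : Matrix n n) → LowerUnitri L → Σ (Matrix n n) λ M → LowerUnitri M × (L ⊗ M) ≈M Id
  lower-inverse n L (L-diag , L-above) =
    transpose V , (proj₁ V-unitri , λ i j i<j → proj₂ V-unitri j i i<j) , L⊗Vᵀ≈Id
    where
      Lᵀ-inverse : Σ (Matrix n n) λ V → UpperUnitri V × (V ⊗ transpose L) ≈M Id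
      Lᵀ-inverse = upper-inverse n (transpose L) (L-diag , λ i j j<i → L-above j i j<i)
      open Σ Lᵀ-inverse renaming (proj₁ to V; proj₂ to V-props)
      V-unitri : UpperUnitri V
      V-unitri = proj₁ V-props
      L⊗Vᵀ≈Id : (L ⊗ transpose V) ≈M Id
      L⊗Vᵀ≈Id i j = begin
        (L ⊗ transpose V) i j ≈⟨ transpose-⊗ V (transpose L) i j ⟨
        (V ⊗ transpose L) j i ≈⟨ proj₂ V-props j i ⟩
        Id j i                ≡⟨ Id-sym j i ⟩
        Id i j                ∎

module Reduction {c ℓ : Level} (R : CommutativeRing c ℓ) where
  open CommutativeRing R using (Carrier)
  open WithRing R
  open Matrices R

  unitriangular-reduction : ∀ {d e} (W T : Matrix d e) (U : Matrix d d) (L : Matrix e e) →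
    UpperUnitri U → LowerUnitri L → W ≈M ((U ⊗ T) ⊗ L) →
    Σ (Matrix d d) λ P → Σ (Matrix e e) λ Q → UpperUnitri P × LowerUnitri Q × ((P ⊗ W) ⊗ Q) ≈M T
  unitriangular-reduction {d} {e} W T U L U-upper L-lower W≈UTL =
    P , Q , proj₁ P-props , proj₁ Q-props , PWQ≈T
    where
      open Σ (upper-inverse d U U-upper) renaming (proj₁ to P; proj₂ to P-props)
      open Σ (lower-inverse e L L-lower) renaming (proj₁ to Q; proj₂ to Q-props)
      open SetoidReasoning (≈M-setoid d e)
      PWQ≈T : ((P ⊗ W) ⊗ Q) ≈M T
      PWQ≈T = begin
        (P ⊗ W) ⊗ Q               ≈⟨ ⊗-cong (⊗-cong ≈M-refl W≈UTL) ≈M-refl ⟩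
        (P ⊗ ((U ⊗ T) ⊗ L)) ⊗ Q   ≈⟨ ⊗-cong (≈M-sym (⊗-assoc P (U ⊗ T) L)) ≈M-refl ⟩
        ((P ⊗ (U ⊗ T)) ⊗ L) ⊗ Q   ≈⟨ ⊗-assoc (P ⊗ (U ⊗ T)) L Q ⟩
        (P ⊗ (U ⊗ T)) ⊗ (L ⊗ Q)   ≈⟨ ⊗-cong (≈M-sym (⊗-assoc P U T)) (proj₂ Q-props) ⟩
        ((P ⊗ U) ⊗ T) ⊗ Id        ≈⟨ ⊗-identityʳ ((P ⊗ U) ⊗ T) ⟩
        (P ⊗ U) ⊗ T               ≈⟨ ⊗-cong (proj₂ P-props) ≈M-refl ⟩
        Id ⊗ T                    ≈⟨ ⊗-identityˡ T ⟩
        T                         ∎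

module GeneratingFunction {c ℓ : Level} (R : CommutativeRing c ℓ) (x : ℕ → ℕ → CommutativeRing.Carrier R) (l : List ℕ) where
  open CommutativeRing R
  open WithRing R
  open WithVars x l
  open FiniteSums R
  open SetoidReasoning setoid
  open CSProperties *-commutativeSemigroup using () renaming (interchange to *-interchange)

  guard : ℕ → ℕ → Carrier → Carrier
  guard zero    n       v = v
  guard (suc m) zero    v = 0#
  guard (suc m) (suc n) v = guard m n v

  guard-≤ : ∀ {m n} v → m ≤ n → guard m n v ≡ v
  guard-≤ {zero}          v _         = P.refl
  guard-≤ {suc m} {suc n} v (s≤s m≤n) = guard-≤ v m≤n

  guard-> : ∀ {m n} v → n < m → guard m n v ≡ 0#
  guard-> {suc m} {zero}  v _         = P.refl
  guard-> {suc m} {suc n} v (s≤s n<m) = guard-> v n<m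

  seg : ℕ → ℕ → ℕ → Carrier
  seg u n a = prodFrom n (suc a) (x u)

  full : ℕ → ℕ → List ℕ → Carrier
  full u s rows = complProd u s rows []

  full-∷ : ∀ u s a rows → full u s (a ∷ rows) ≈ seg u s a * full (suc u) s rows
  full-∷ u s a rows = *-congʳ (prodL-range (x u) s a)

  -- Gen u lo hi rows: the sum, over all subdiagrams μ of the rows `rows` (the first
  -- being row u) restricted to columns ≥ lo, whose first row stops before column hi,
  -- of the product of x over the complement. Row by row μ is described by its cut
  -- n (μ occupies columns lo … n-1); cuts weakly decrease and are at most hi.
  Gen : ℕ → ℕ → ℕ → List ℕ → Carrier
  Gen u lo hi []       = guard lo hi 1#
  Gen u lo hi (a ∷ as) = sumFrom lo (suc (hi ⊓ (suc a ⊔ lo))) (λ n → seg u n a * Gen (suc u) lo n as)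

  -- The smallest cap that does not restrict the cut of the first row.
  capFree : ℕ → List ℕ → ℕ
  capFree lo []      = lo
  capFree lo (a ∷ _) = suc a ⊔ lo

  Gen-below : ∀ u {lo hi} rows → hi < lo → Gen u lo hi rows ≈ 0#
  Gen-below u []       hi<lo = reflexive (guard-> 1# hi<lo)
  Gen-below u {lo} {hi} (a ∷ as) hi<lo =
    reflexive (sumFrom-empty lo _ (λ n → seg u n a * Gen (suc u) lo n as) (NP.≤-trans (s≤s (NP.m⊓n≤m hi _)) hi<lo))

  Gen-cap : ∀ u lo {hi hi'} rows → capFree lo rows ≤ hi → capFree lo rows ≤ hi' → Gen u lo hi rows ≡ Gen u lo hi' rows
  Gen-cap u lo []       lo≤hi lo≤hi' = P.trans (guard-≤ 1# lo≤hi) (P.sym (guard-≤ 1# lo≤hi'))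
  Gen-cap u lo (a ∷ as) free≤hi free≤hi' =
    P.cong (λ t → sumFrom lo (suc t) (λ n → seg u n a * Gen (suc u) lo n as))
           (P.trans (NP.m≥n⇒m⊓n≡n free≤hi) (P.sym (NP.m≥n⇒m⊓n≡n free≤hi')))

  seg-split : ∀ u n a c → n ≤ suc c → seg u n a ≈ seg u n (a ⊓ c) * seg u (suc c) a
  seg-split u n a c n≤c+1 with NP.≤-total a c
  ... | inj₁ a≤c rewrite NP.m≤n⇒m⊓n≡m a≤c | prodFrom-empty (suc c) (suc a) (x u) (s≤s a≤c) = sym (*-identityʳ _)
  ... | inj₂ c≤a rewrite NP.m≥n⇒m⊓n≡n c≤a = prodFrom-split (x u) n≤c+1 (s≤s c≤a)

  -- Factoring: when no cut can pass column c+1 (hi ≤ c+1), every square in a column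
  -- > c lies in the complement, so those squares contribute their full product.
  Gen-factor : ∀ u lo hi c rows → hi ≤ suc c → Gen u lo hi rows ≈ full u (suc c) rows * Gen u lo hi (map (_⊓ c) rows)
  Gen-factor u lo hi c []       _       = sym (*-identityˡ _)
  Gen-factor u lo hi c (a ∷ as) hi≤c+1 = begin
    sumFrom lo top g                 ≈⟨ sumFrom-cong lo top {g} termwise ⟩
    sumFrom lo top (λ n → A * g' n)  ≈⟨ sumN-*ˡ (top ∸ lo) A _ ⟨
    A * sumFrom lo top g'            ≡⟨ P.cong (λ t → A * sumFrom lo (suc t) g') (P.sym (capped-top lo hi a c hi≤c+1)) ⟩
    A * Gen u lo hi (map (_⊓ c) (a ∷ as)) ∎
    where
      top : ℕ
      top = suc (hi ⊓ (suc a ⊔ lo))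
      A : Carrier
      A = full u (suc c) (a ∷ as)
      g g' : ℕ → Carrier
      g  n = seg u n a * Gen (suc u) lo n as
      g' n = seg u n (a ⊓ c) * Gen (suc u) lo n (map (_⊓ c) as)
      termwise : ∀ n → lo ≤ n → n < top → g n ≈ A * g' n
      termwise n _ (s≤s n≤top) = begin
        seg u n a * Gen (suc u) lo n as
          ≈⟨ *-cong (seg-split u n a c n≤c+1) (Gen-factor (suc u) lo n c as n≤c+1) ⟩
        (seg u n (a ⊓ c) * seg u (suc c) a) * (full (suc u) (suc c) as * Gen (suc u) lo n (map (_⊓ c) as))
          ≈⟨ *-congʳ (*-comm _ _) ⟩
        (seg u (suc c) a * seg u n (a ⊓ c)) * (full (suc u) (suc c) as * Gen (suc u) lo n (map (_⊓ c) as))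
          ≈⟨ *-interchange _ _ _ _ ⟩
        (seg u (suc c) a * full (suc u) (suc c) as) * g' n
          ≈⟨ *-congʳ (full-∷ u (suc c) a as) ⟨
        A * g' n ∎
        where
          n≤c+1 : n ≤ suc c
          n≤c+1 = NP.≤-trans n≤top (NP.≤-trans (NP.m⊓n≤m hi _) hi≤c+1)

  -- With lower bound and cap both c+1, rows capped at c admit only the empty cut pattern.
  Gen-trivial : ∀ u c rows → Gen u (suc c) (suc c) (map (_⊓ c) rows) ≈ 1#
  Gen-trivial u c []       = reflexive (guard-≤ {suc c} 1# NP.≤-refl)
  Gen-trivial u c (a ∷ as) = begin
    sumFrom (suc c) (suc (suc c ⊓ (suc (a ⊓ c) ⊔ suc c))) g
      ≡⟨ P.cong (λ t → sumFrom (suc c) (suc t) g) top≡ ⟩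
    sumFrom (suc c) (suc (suc c)) g  ≈⟨ sumFrom-single (suc c) g ⟩
    seg u (suc c) (a ⊓ c) * Gen (suc u) (suc c) (suc c) (map (_⊓ c) as)
      ≈⟨ *-cong (reflexive (prodFrom-empty (suc c) (suc (a ⊓ c)) (x u) (s≤s (NP.m⊓n≤n a c)))) (Gen-trivial (suc u) c as) ⟩
    1# * 1#  ≈⟨ *-identityˡ 1# ⟩
    1# ∎
    where
      g : ℕ → Carrier
      g n = seg u n (a ⊓ c) * Gen (suc u) (suc c) n (map (_⊓ c) as)
      top≡ : suc c ⊓ (suc (a ⊓ c) ⊔ suc c) ≡ suc c
      top≡ = P.trans (P.cong (suc c ⊓_) (NP.m≤n⇒m⊔n≡n (s≤s (NP.m⊓n≤n a c)))) (NP.⊓-idem (suc c))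

  -- The part of Gen in which the cuts cross the diagonal at row K: the first K rows
  -- are cut at columns ≥ K + c and the remaining ones at columns ≤ K + c.
  crossing : ℕ → ℕ → ℕ → ℕ → List ℕ → ℕ → Carrier
  crossing u lo hi c rows K = Gen u (K N.+ c) hi (take K rows) * Gen (K N.+ u) lo (K N.+ c) (drop K rows)

  -- Prepending a row of length a ≥ K + c: its cuts n ≥ lo ⊔ (c+1), combined with the
  -- crossing at row K of the remaining rows (diagonal shifted to c+1), give the
  -- crossing at row K+1. Cuts n < K + c + 1 contribute nothing to the upper factor.
  crossing-cons : ∀ u lo hi c a as K → K N.+ c ≤ a →
    sumFrom (lo ⊔ suc c) (suc (hi ⊓ (suc a ⊔ lo))) (λ n → seg u n a * crossing (suc u) lo n (suc c) as K)
      ≈ crossing u lo hi c (a ∷ as) (suc K)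
  crossing-cons u lo hi c a as K K+c≤a = begin
    sumFrom lo* top (λ n → seg u n a * crossing (suc u) lo n (suc c) as K)
      ≈⟨ sumFrom-cong lo* top {λ n → seg u n a * crossing (suc u) lo n (suc c) as K}
                      (λ n _ _ → trans (*-congˡ (reflexive (crossing-shift n))) (sym (*-assoc _ _ _))) ⟩
    sumFrom lo* top (λ n → h n * B)  ≈⟨ sumN-*ʳ (top ∸ lo*) B (λ m → h (lo* N.+ m)) ⟨
    sumFrom lo* top h * B            ≈⟨ upper-factor (lo N.≤? c') ⟩
    sumFrom c' (suc (hi ⊓ (suc a ⊔ c'))) h * B ∎
    where
      lo* top c' : ℕ
      lo* = lo ⊔ suc c
      top = suc (hi ⊓ (suc a ⊔ lo))
      c'  = suc (K N.+ c)
      B : Carrier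
      B = Gen (suc (K N.+ u)) lo c' (drop K as)
      h : ℕ → Carrier
      h n = seg u n a * Gen (suc u) c' n (take K as)
      crossing-shift : ∀ n → crossing (suc u) lo n (suc c) as K ≡ Gen (suc u) c' n (take K as) * B
      crossing-shift n =
        P.cong₂ (λ p q → Gen (suc u) p n (take K as) * Gen q lo p (drop K as)) (NP.+-suc K c) (NP.+-suc K u)
      -- If lo ≤ c' the cuts below c' vanish and the ranges agree; otherwise B = 0.
      upper-factor : Dec (lo ≤ c') → sumFrom lo* top h * B ≈ sumFrom c' (suc (hi ⊓ (suc a ⊔ c'))) h * B
      upper-factor (yes lo≤c') = *-congʳ (trans (sumFrom-skip top h lo*≤c' below-c'-vanishes)
                                                (reflexive (P.cong (λ t → sumFrom c' (suc (hi ⊓ t)) h) same-top)))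
        where
          lo*≤c' : lo* ≤ c'
          lo*≤c' = NP.⊔-lub lo≤c' (s≤s (NP.m≤n+m c K))
          below-c'-vanishes : ∀ n → lo* ≤ n → n < c' → h n ≈ 0#
          below-c'-vanishes n _ n<c' = trans (*-congˡ (Gen-below (suc u) (take K as) n<c')) (zeroʳ _)
          same-top : suc a ⊔ lo ≡ suc a ⊔ c'
          same-top = P.trans (NP.m≥n⇒m⊔n≡m (NP.≤-trans lo≤c' (s≤s K+c≤a))) (P.sym (NP.m≥n⇒m⊔n≡m (s≤s K+c≤a)))
      upper-factor (no lo≰c') =
        trans (*-congˡ B≈0) (trans (zeroʳ _) (sym (trans (*-congˡ B≈0) (zeroʳ _))))
        where
          B≈0 : B ≈ 0#
          B≈0 = Gen-below (suc (K N.+ u)) (drop K as) (NP.≰⇒> lo≰c')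

  Gen-staircase : ∀ {lo c rows N} → Staircase lo c rows N → ∀ u hi → c ≤ hi →
    Gen u lo hi rows ≈ sumN (suc N) (crossing u lo hi c rows)
  Gen-staircase {lo} {c} (end lo≤c) u hi c≤hi = begin
    guard lo hi 1#                       ≡⟨ guard-≤ 1# (NP.≤-trans lo≤c c≤hi) ⟩
    1#                                   ≈⟨ *-identityˡ 1# ⟨
    1# * 1#                              ≡⟨ P.cong₂ _*_ (guard-≤ 1# c≤hi) (guard-≤ 1# lo≤c) ⟨
    guard c hi 1# * guard lo c 1#        ≈⟨ +-identityʳ _ ⟨
    guard c hi 1# * guard lo c 1# + 0#   ∎
  Gen-staircase {lo} {c} {a ∷ as} (short a<c lo≤c) u hi c≤hi = begin
    Gen u lo hi (a ∷ as)                      ≡⟨ Gen-cap u lo (a ∷ as) (NP.≤-trans free≤c c≤hi) free≤c ⟩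
    Gen u lo c (a ∷ as)                       ≈⟨ *-identityˡ _ ⟨
    1# * Gen u lo c (a ∷ as)                  ≡⟨ P.cong (_* Gen u lo c (a ∷ as)) (P.sym (guard-≤ 1# c≤hi)) ⟩
    guard c hi 1# * Gen u lo c (a ∷ as)       ≈⟨ +-identityʳ _ ⟨
    guard c hi 1# * Gen u lo c (a ∷ as) + 0#  ∎
    where
      free≤c : capFree lo (a ∷ as) ≤ c
      free≤c = NP.⊔-lub a<c lo≤c
  Gen-staircase {lo} {c} {a ∷ as} {suc N} (long c+N≤a stairs) u hi c≤hi = begin
    sumFrom lo top g                                   ≈⟨ sumFrom-split⊔ lo (suc c) top g c+1≤top ⟩
    sumFrom lo (suc c) g + sumFrom (lo ⊔ suc c) top g  ≈⟨ +-cong below-diagonal beyond-diagonal ⟩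
    sumN (suc (suc N)) (crossing u lo hi c (a ∷ as))   ∎
    where
      top : ℕ
      top = suc (hi ⊓ (suc a ⊔ lo))
      g : ℕ → Carrier
      g n = seg u n a * Gen (suc u) lo n as
      c≤a+1⊔lo : c ≤ suc a ⊔ lo
      c≤a+1⊔lo = NP.≤-trans (NP.≤-trans (NP.≤-trans (NP.m≤m+n c N) c+N≤a) (NP.n≤1+n a)) (NP.m≤m⊔n (suc a) lo)
      c+1≤top : suc c ≤ top
      c+1≤top = s≤s (NP.⊓-glb c≤hi c≤a+1⊔lo)
      -- Cuts of the first row at columns ≤ c: the crossing at row 0.
      below-diagonal : sumFrom lo (suc c) g ≈ crossing u lo hi c (a ∷ as) 0
      below-diagonal = begin
        sumFrom lo (suc c) g       ≡⟨ P.cong (λ t → sumFrom lo (suc t) g) (P.sym (NP.m≤n⇒m⊓n≡m c≤a+1⊔lo)) ⟩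
        Gen u lo c (a ∷ as)        ≈⟨ *-identityˡ _ ⟨
        1# * Gen u lo c (a ∷ as)   ≡⟨ P.cong (_* Gen u lo c (a ∷ as)) (P.sym (guard-≤ 1# c≤hi)) ⟩
        crossing u lo hi c (a ∷ as) 0 ∎
      -- Cuts of the first row beyond column c: expand the remaining rows by the
      -- decomposition of the shifted staircase and exchange the two sums.
      lo* : ℕ
      lo* = lo ⊔ suc c
      expand : ∀ n → suc c ≤ n → g n ≈ sumN (suc N) (λ K → seg u n a * crossing (suc u) lo n (suc c) as K)
      expand n c+1≤n = trans (*-congˡ (Gen-staircase stairs (suc u) n c+1≤n))
                             (sumN-*ˡ (suc N) (seg u n a) (crossing (suc u) lo n (suc c) as))
      beyond-diagonal : sumFrom lo* top g ≈ sumN (suc N) (λ K → crossing u lo hi c (a ∷ as) (suc K))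
      beyond-diagonal = begin
        sumFrom lo* top g
          ≈⟨ sumFrom-cong lo* top {g} (λ n lo*≤n _ → expand n (NP.≤-trans (NP.m≤n⊔m lo (suc c)) lo*≤n)) ⟩
        sumFrom lo* top (λ n → sumN (suc N) (λ K → seg u n a * crossing (suc u) lo n (suc c) as K))
          ≈⟨ sumN-swap (top ∸ lo*) (suc N) (λ m K → seg u (lo* N.+ m) a * crossing (suc u) lo (lo* N.+ m) (suc c) as K) ⟩
        sumN (suc N) (λ K → sumFrom lo* top (λ n → seg u n a * crossing (suc u) lo n (suc c) as K))
          ≈⟨ sumN-cong (suc N) (λ K K<N+1 → crossing-cons u lo hi c a as K (K+c≤a K (NP.≤-pred K<N+1))) ⟩
        sumN (suc N) (λ K → crossing u lo hi c (a ∷ as) (suc K)) ∎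
        where
          K+c≤a : ∀ K → K ≤ N → K N.+ c ≤ a
          K+c≤a K K≤N = NP.≤-trans (NP.+-monoˡ-≤ c K≤N) (NP.≤-trans (NP.≤-reflexive (NP.+-comm N c)) c+N≤a)

  -- The definition of P_{rs} enumerates the subdiagrams μ of the rows (in columns > s) by their
  -- row lengths m, capped by cap in the first row; the corresponding cut is s + 1 + m.
  subsCap-Gen : ∀ u s cap rows →
    sumL (map (complProd u (suc s) rows) (subsCap cap (map (_∸ s) rows))) ≈ Gen u (suc s) (suc s N.+ cap) rows
  subsCap-Gen u s cap []       = trans (+-identityʳ 1#) (reflexive (P.sym (guard-≤ 1# (NP.m≤m+n (suc s) cap))))
  subsCap-Gen u s cap (a ∷ as) = begin
    sumL (map F (concatMap (λ m → map (m ∷_) (subsCap m bs)) (upTo (suc (cap ⊓ (a ∸ s))))))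
      ≈⟨ sumL-concatMap F (λ m → map (m ∷_) (subsCap m bs)) (upTo (suc (cap ⊓ (a ∸ s)))) ⟩
    sumL (map (λ m → sumL (map F (map (m ∷_) (subsCap m bs)))) (upTo (suc (cap ⊓ (a ∸ s)))))
      ≈⟨ sumL-map-cong (upTo (suc (cap ⊓ (a ∸ s)))) by-first-row ⟩
    sumL (map g (upTo (suc (cap ⊓ (a ∸ s)))))
      ≈⟨ sumL-applyUpTo g (λ m → m) (suc (cap ⊓ (a ∸ s))) ⟩
    sumN (suc (cap ⊓ (a ∸ s))) g
      ≡⟨ P.cong (λ t → sumN t g) (cut-count s cap a) ⟨
    Gen u (suc s) (suc s N.+ cap) (a ∷ as) ∎
    where
      F : List ℕ → Carrier
      F = complProd u (suc s) (a ∷ as)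
      bs : List ℕ
      bs = map (_∸ s) as
      g : ℕ → Carrier
      g m = seg u (suc s N.+ m) a * Gen (suc u) (suc s) (suc s N.+ m) as
      by-first-row : ∀ m → sumL (map F (map (m ∷_) (subsCap m bs))) ≈ g m
      by-first-row m = begin
        sumL (map F (map (m ∷_) (subsCap m bs)))
          ≡⟨ P.cong sumL (LP.map-∘ (subsCap m bs)) ⟨
        sumL (map (λ ms → prodL (map (x u) (range (suc s N.+ m) a)) * complProd (suc u) (suc s) as ms) (subsCap m bs))
          ≈⟨ sumL-*ˡ (prodL (map (x u) (range (suc s N.+ m) a))) (complProd (suc u) (suc s) as) (subsCap m bs) ⟩
        prodL (map (x u) (range (suc s N.+ m) a)) * sumL (map (complProd (suc u) (suc s) as) (subsCap m bs))
          ≈⟨ *-cong (prodL-range (x u) (suc s N.+ m) a) (subsCap-Gen (suc u) s m as) ⟩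
        g m ∎

  Pent-Gen : ∀ i j → Pent (suc i) (suc j) ≈ Gen (suc i) (suc j) (capFree (suc j) (drop i l)) (drop i l)
  Pent-Gen i j = rows-Gen (drop i l)
    where
      rows-Gen : ∀ rows → sumL (map (complProd (suc i) (suc j) rows) (subs (map (_∸ j) rows)))
                          ≈ Gen (suc i) (suc j) (capFree (suc j) rows) rows
      rows-Gen []       = trans (+-identityʳ 1#) (reflexive (P.sym (guard-≤ {suc j} 1# NP.≤-refl)))
      rows-Gen (a ∷ as) = trans (subsCap-Gen (suc i) j (a ∸ j) (a ∷ as))
                                (reflexive (P.cong (λ t → Gen (suc i) (suc j) t (a ∷ as)) (P.sym (suc⊔suc a j))))

module Factorization {c ℓ : Level} (R : CommutativeRing c ℓ) (x : ℕ → ℕ → CommutativeRing.Carrier R) (l : List ℕ) where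
  open CommutativeRing R
  open WithRing R
  open WithVars x l
  open FiniteSums R
  open Matrices R using (sumFin-cong; sumFin-*ʳ; sumFin-swap; sumFin-toℕ)
  open GeneratingFunction R x l
  open SetoidReasoning setoid

  -- The entries of the unitriangular factors of W_F (0-based indices, off = e - d).
  -- U_{ik} = [i ≤ k] · Gen of the rows i+1 … k in the columns > k + off, uncapped.
  Uent : ℕ → ℕ → ℕ → Carrier
  Uent off i k = guard i k (Gen (suc i) (suc (k N.+ off)) (capFree (suc (k N.+ off)) rows) rows)
    where rows = take (k ∸ i) (drop i l)

  Lent : ℕ → ℕ → ℕ → Carrier
  Lent off c j = Gen (suc (c ∸ off)) (suc j) (suc c) (map (_⊓ c) (drop (c ∸ off) l))

  -- U is upper unitriangular: below the diagonal the guard vanishes, on it no rows remain.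
  U-upper : ∀ {n} off → UpperUnitri {n} (λ i k → Uent off (toℕ i) (toℕ k))
  U-upper off = (λ i → reflexive (P.trans (guard-≤ _ (NP.≤-refl {toℕ i})) (U-diag (toℕ i))))
              , (λ i k k<i → reflexive (guard-> _ k<i))
    where
      U-diag : ∀ i → Gen (suc i) (suc (i N.+ off)) (capFree (suc (i N.+ off)) (take (i ∸ i) (drop i l))) (take (i ∸ i) (drop i l)) ≡ 1#
      U-diag i rewrite NP.n∸n≡0 i = guard-≤ {suc (i N.+ off)} 1# NP.≤-refl

  -- L is lower unitriangular, by Gen-trivial on the diagonal and Gen-below above it.
  L-lower : ∀ {n} off → LowerUnitri {n} (λ c j → Lent off (toℕ c) (toℕ j))
  L-lower off = (λ c → Gen-trivial (suc (toℕ c ∸ off)) (toℕ c) (drop (toℕ c ∸ off) l))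
              , (λ c j c<j → Gen-below (suc (toℕ c ∸ off)) (map (_⊓ toℕ c) (drop (toℕ c ∸ off) l)) (s≤s c<j))

  capFree-take : ∀ {lo c rows N} → Staircase lo c rows N → ∀ K → K ≤ N →
    capFree (K N.+ c) (take K rows) ≤ capFree lo rows ⊔ c
  capFree-take {lo} {c} {rows} _ zero _ = NP.m≤n⊔m (capFree lo rows) c
  capFree-take {lo} {c} (long {a = a} {N = N} c+N≤a _) (suc K) (s≤s K≤N) =
    NP.⊔-lub a+1≤cap (NP.≤-trans (s≤s K+c≤a) a+1≤cap)
    where
      a+1≤cap : suc a ≤ (suc a ⊔ lo) ⊔ c
      a+1≤cap = NP.≤-trans (NP.m≤m⊔n (suc a) lo) (NP.m≤m⊔n (suc a ⊔ lo) c)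
      K+c≤a : K N.+ c ≤ a
      K+c≤a = NP.≤-trans (NP.+-monoˡ-≤ c K≤N) (NP.≤-trans (NP.≤-reflexive (NP.+-comm N c)) c+N≤a)

  crossing-≡ : ∀ {u lo hi c rows} K {c' u' rows'} → K N.+ c ≡ c' → K N.+ u ≡ u' → drop K rows ≡ rows' →
    crossing u lo hi c rows K ≡ Gen u c' hi (take K rows) * Gen u' lo c' rows'
  crossing-≡ K P.refl P.refl P.refl = P.refl

  entryCap : ℕ → ℕ → ℕ → ℕ
  entryCap off i j = capFree (suc j) (drop i l) ⊔ suc (i N.+ off)

  -- The term k = i + K of (U · A · L)_{ij} is the crossing at row K: U supplies the
  -- rows above the crossing, A · L (by factoring) the rows from the crossing on.
  factor-term : ∀ off i j {N} K → Staircase (suc j) (suc (i N.+ off)) (drop i l) N → K ≤ N →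
    let k = i N.+ K in
    Uent off i k * (full (suc k) (suc (k N.+ off)) (drop k l) * Lent off (k N.+ off) j)
      ≈ crossing (suc i) (suc j) (entryCap off i j) (suc (i N.+ off)) (drop i l) K
  factor-term off i j K stairs K≤N = begin
    Uent off i k * (full (suc k) (suc cc) (drop k l) * Lent off cc j)
      ≡⟨ P.cong₂ (λ p q → p * (full (suc k) (suc cc) (drop k l) * q)) U≡ L≡ ⟩
    Gen (suc i) (suc cc) H (take K rows) * (full (suc k) (suc cc) (drop k l) * Gen (suc k) (suc j) (suc cc) (map (_⊓ cc) (drop k l)))
      ≈⟨ *-congˡ (Gen-factor (suc k) (suc j) (suc cc) cc (drop k l) NP.≤-refl) ⟨
    Gen (suc i) (suc cc) H (take K rows) * Gen (suc k) (suc j) (suc cc) (drop k l)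
      ≡⟨ crossing-≡ K (column-shift K i off) (row-shift K i) (LP.drop-drop i K l) ⟨
    crossing (suc i) (suc j) H (suc (i N.+ off)) rows K ∎
    where
      k cc H : ℕ
      k  = i N.+ K
      cc = k N.+ off
      H  = entryCap off i j
      rows : List ℕ
      rows = drop i l
      U≡ : Uent off i k ≡ Gen (suc i) (suc cc) H (take K rows)
      U≡ = P.trans (guard-≤ _ (NP.m≤m+n i K))
             (P.trans (P.cong (λ t → Gen (suc i) (suc cc) (capFree (suc cc) (take t rows)) (take t rows)) (NP.m+n∸m≡n i K))
                      (Gen-cap (suc i) (suc cc) (take K rows) NP.≤-refl
                               (P.subst (λ t → capFree t (take K rows) ≤ H) (column-shift K i off) (capFree-take stairs K K≤N))))
      L≡ : Lent off cc j ≡ Gen (suc k) (suc j) (suc cc) (map (_⊓ cc) (drop k l))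
      L≡ = P.cong (λ t → Gen (suc t) (suc j) (suc cc) (map (_⊓ cc) (drop t l))) (NP.m+n∸n≡m k off)

  -- (U · A · L)_{ij} = P_{i+1,j+1}: the terms with k < i vanish (U is upper
  -- triangular), the others are the crossings of the staircase decomposition.
  factorization-entry : ∀ off i j N → Staircase (suc j) (suc (i N.+ off)) (drop i l) N →
    sumN (i N.+ suc N) (λ k → Uent off i k * (full (suc k) (suc (k N.+ off)) (drop k l) * Lent off (k N.+ off) j))
      ≈ Pent (suc i) (suc j)
  factorization-entry off i j N stairs = begin
    sumN (i N.+ suc N) t
      ≈⟨ sumN-split i (suc N) t ⟩
    sumN i t + sumN (suc N) (λ K → t (i N.+ K))
      ≈⟨ +-cong (sumN-vanish i (λ k k<i → trans (*-congʳ (reflexive (guard-> _ k<i))) (zeroˡ _)))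
                (sumN-cong (suc N) (λ K K<N+1 → factor-term off i j K stairs (NP.≤-pred K<N+1))) ⟩
    0# + sumN (suc N) (crossing (suc i) (suc j) H (suc (i N.+ off)) rows)
      ≈⟨ +-identityˡ _ ⟩
    sumN (suc N) (crossing (suc i) (suc j) H (suc (i N.+ off)) rows)
      ≈⟨ Gen-staircase stairs (suc i) H (NP.m≤n⊔m _ _) ⟨
    Gen (suc i) (suc j) H rows
      ≡⟨ Gen-cap (suc i) (suc j) rows (NP.m≤m⊔n _ _) NP.≤-refl ⟩
    Gen (suc i) (suc j) (capFree (suc j) rows) rows
      ≈⟨ Pent-Gen i j ⟨
    Pent (suc i) (suc j) ∎
    where
      rows : List ℕ
      rows = drop i l
      H : ℕ
      H = entryCap off i j
      t : ℕ → Carrier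
      t k = Uent off i k * (full (suc k) (suc (k N.+ off)) (drop k l) * Lent off (k N.+ off) j)

  select : ℕ → ℕ → Carrier → Carrier
  select m n v with m NP.≟ n
  ... | yes _ = v
  ... | no  _ = 0#

  select-≡ : ∀ m v → select m m v ≡ v
  select-≡ m v with m NP.≟ m
  ... | yes _  = P.refl
  ... | no m≢m = ⊥-elim (m≢m P.refl)

  select-≢ : ∀ {m n} v → m ≢ n → select m n v ≡ 0#
  select-≢ {m} {n} v m≢n with m NP.≟ n
  ... | yes m≡n = ⊥-elim (m≢n m≡n)
  ... | no  _   = P.refl

  Target-select : ∀ {d e} (k : Fin d) (c : Fin e) →
    Target d e k c ≡ select (toℕ c) (toℕ k N.+ (e ∸ d)) (Aent (suc (toℕ k)) (suc (toℕ c)))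
  Target-select {d} {e} k c with toℕ c NP.≟ toℕ k N.+ (e ∸ d)
  ... | yes _ = P.refl
  ... | no  _ = P.refl

  Target-square : ∀ {n} (i j : Fin n) → Target n n i j ≈ DiagA n i j
  Target-square {n} i j with toℕ i NP.≟ toℕ j
  ... | yes i≡j = begin
    Target n n i j                                       ≡⟨ Target-select i j ⟩
    select (toℕ j) (toℕ i N.+ (n ∸ n)) (A (toℕ j))       ≡⟨ P.cong (λ t → select (toℕ j) t (A (toℕ j))) (P.trans diag-col i≡j) ⟩
    select (toℕ j) (toℕ j) (A (toℕ j))                   ≡⟨ select-≡ (toℕ j) _ ⟩
    A (toℕ j)                                            ≡⟨ P.cong A i≡j ⟨
    A (toℕ i)                                            ∎
    where
      A : ℕ → Carrier
      A m = Aent (suc (toℕ i)) (suc m)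
      diag-col : toℕ i N.+ (n ∸ n) ≡ toℕ i
      diag-col = P.trans (P.cong (toℕ i N.+_) (NP.n∸n≡0 n)) (NP.+-identityʳ (toℕ i))
  ... | no i≢j = reflexive (P.trans (Target-select i j) (select-≢ _ (λ j≡i+0 → i≢j (P.sym (P.trans j≡i+0 diag-col)))))
    where
      diag-col : toℕ i N.+ (n ∸ n) ≡ toℕ i
      diag-col = P.trans (P.cong (toℕ i N.+_) (NP.n∸n≡0 n)) (NP.+-identityʳ (toℕ i))

  -- Row k of T has the single nonzero entry A_{k+1,k+off+1}, in column k + off, so
  -- multiplying a row by T and then a column selects that index.
  through-Target : ∀ {d e} → d ≤ e → (y : Carrier) (z : ℕ → Carrier) (k : Fin d) →
    sumFin {e} (λ c → (y * Target d e k c) * z (toℕ c))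
      ≈ y * (Aent (suc (toℕ k)) (suc (toℕ k N.+ (e ∸ d))) * z (toℕ k N.+ (e ∸ d)))
  through-Target {d} {e} d≤e y z k = begin
    sumFin (λ c → (y * Target d e k c) * z (toℕ c))
      ≈⟨ sumFin-cong e (λ c → reflexive (P.cong (λ v → (y * v) * z (toℕ c)) (Target-select k c))) ⟩
    sumFin {e} (λ c → h (toℕ c))  ≡⟨ sumFin-toℕ e h ⟩
    sumN e h                      ≈⟨ sumN-single e col h col<e off-diagonal ⟩
    h col                         ≡⟨ P.cong (λ v → (y * v) * z col) (select-≡ col _) ⟩
    (y * A col) * z col           ≈⟨ *-assoc _ _ _ ⟩
    y * (A col * z col)           ∎
    where
      col : ℕ
      col = toℕ k N.+ (e ∸ d)
      A : ℕ → Carrier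
      A m = Aent (suc (toℕ k)) (suc m)
      h : ℕ → Carrier
      h m = (y * select m col (A m)) * z m
      col<e : col < e
      col<e = P.subst (col <_) (NP.m+[n∸m]≡n d≤e) (NP.+-monoˡ-< (e ∸ d) (FP.toℕ<n k))
      off-diagonal : ∀ m → m ≢ col → h m ≈ 0#
      off-diagonal m m≢col = trans (*-congʳ (trans (*-congˡ (reflexive (select-≢ _ m≢col))) (zeroʳ _))) (zeroˡ _)

  U-matrix : ∀ {n} → ℕ → Matrix n n
  U-matrix off i k = Uent off (toℕ i) (toℕ k)

  L-matrix : ∀ {n} → ℕ → Matrix n n
  L-matrix off c j = Lent off (toℕ c) (toℕ j)

  W-factorization : ∀ d e → d ≤ e →
    (∀ i j → i < d → j < e → Staircase (suc j) (suc (i N.+ (e ∸ d))) (drop i l) (d ∸ suc i)) →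
    W d e ≈M ((U-matrix (e ∸ d) ⊗ Target d e) ⊗ L-matrix (e ∸ d))
  W-factorization d e d≤e stairs i j = sym (begin
    sumFin (λ c → sumFin (λ k → U i k * Target d e k c) * L c j)
      ≈⟨ sumFin-cong e (λ c → sumFin-*ʳ d (L c j) (λ k → U i k * Target d e k c)) ⟩
    sumFin (λ c → sumFin (λ k → (U i k * Target d e k c) * L c j))
      ≈⟨ sumFin-swap e d (λ c k → (U i k * Target d e k c) * L c j) ⟩
    sumFin (λ k → sumFin (λ c → (U i k * Target d e k c) * L c j))
      ≈⟨ sumFin-cong d (λ k → through-Target d≤e (U i k) (λ m → Lent off m (toℕ j)) k) ⟩
    sumFin {d} (λ k → t (toℕ k))  ≡⟨ sumFin-toℕ d t ⟩
    sumN d t                      ≡⟨ P.cong (λ n → sumN n t) d≡i+N+1 ⟩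
    sumN (toℕ i N.+ suc N) t
      ≈⟨ factorization-entry off (toℕ i) (toℕ j) N (stairs (toℕ i) (toℕ j) (FP.toℕ<n i) (FP.toℕ<n j)) ⟩
    Pent (suc (toℕ i)) (suc (toℕ j)) ∎)
    where
      off N : ℕ
      off = e ∸ d
      N = d ∸ suc (toℕ i)
      U : Matrix d d
      U = U-matrix off
      L : Matrix e e
      L = L-matrix off
      t : ℕ → Carrier
      t k = Uent off (toℕ i) k * (full (suc k) (suc (k N.+ off)) (drop k l) * Lent off (k N.+ off) (toℕ j))
      d≡i+N+1 : d ≡ toℕ i N.+ suc N
      d≡i+N+1 = P.trans (P.sym (NP.m+[n∸m]≡n (FP.toℕ<n i))) (P.sym (NP.+-suc (toℕ i) N))

module MainResults {c ℓ : Level} (R : CommutativeRing c ℓ) (x : ℕ → ℕ → CommutativeRing.Carrier R) (l : List ℕ) where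
  open CommutativeRing R using (trans)
  open WithRing R
  open WithVars x l
  open Factorization R x l
  open Reduction R
  open Shapes

  rectangle : (d e : ℕ) → 1 ≤ d → d ≤ e →
    (∀ i j → 1 ≤ i → i ≤ d → 1 ≤ j → j ≤ e → InStar l i j) → ¬ InDiagram l d e →
    Σ (Matrix d d) λ P → Σ (Matrix e e) λ Q → UpperUnitri P × LowerUnitri Q × ((P ⊗ W d e) ⊗ Q) ≈M Target d e
  rectangle d e 1≤d d≤e F⊆λ* corner∉λ =
    unitriangular-reduction (W d e) (Target d e) (U-matrix off) (L-matrix off) (U-upper off) (L-lower off)
      (W-factorization d e d≤e (λ i j i<d j<e → staircase j j<e (d ∸ suc i) i (NP.m+[n∸m]≡n i<d)))
    where open Rectangle l d e 1≤d d≤e F⊆λ* corner∉λ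

  square : IsPartition l → (ρ : ℕ) → IsRank l ρ →
    Σ (Matrix (suc ρ) (suc ρ)) λ P → Σ (Matrix (suc ρ) (suc ρ)) λ Q →
      UpperUnitri P × LowerUnitri Q × ((P ⊗ W (suc ρ) (suc ρ)) ⊗ Q) ≈M DiagA (suc ρ)
  square (_ , desc) ρ rank with rectangle (suc ρ) (suc ρ) (s≤s z≤n) NP.≤-refl square⊆λ* corner∉λ
    where open Square l desc ρ rank
  ... | P , Q , P-upper , Q-lower , PWQ≈T = P , Q , P-upper , Q-lower , λ i j → trans (PWQ≈T i j) (Target-square i j)

theorem3 : {c ℓ : Level} (R : CommutativeRing c ℓ)
  (x : ℕ → ℕ → CommutativeRing.Carrier R) (l : List ℕ) → IsPartition l →
  let open WithRing R
      open WithVars x l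
  in ((d e : ℕ) → 1 ≤ d → d ≤ e →
      (∀ i j → 1 ≤ i → i ≤ d → 1 ≤ j → j ≤ e → InStar l i j) →
      ¬ InDiagram l d e →
      Σ (Matrix d d) λ P → Σ (Matrix e e) λ Q →
        UpperUnitri P × LowerUnitri Q × ((P ⊗ W d e) ⊗ Q) ≈M Target d e)
   × ((ρ : ℕ) → IsRank l ρ →
      Σ (Matrix (suc ρ) (suc ρ)) λ P → Σ (Matrix (suc ρ) (suc ρ)) λ Q →
        UpperUnitri P × LowerUnitri Q
          × ((P ⊗ W (suc ρ) (suc ρ)) ⊗ Q) ≈M DiagA (suc ρ))
theorem3 R x l isPartition = MainResults.rectangle R x l , MainResults.square R x l isPartition
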